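{- Let $I=(L,D_{\rm sem},V_{\rm sem})$ be an interpreted language, let $L_{\rm obj}\subseteq L$, and let $F=(D_{\rm syn},V_{\rm syn},L_{\rm syn},Q,E)$ be a syntax framework for $(L_{\rm obj},I)$ that has built-in quotation and built-in evaluation. Then $E\neq E^{\ast}$, where $E^{\ast}$ is the direct evaluation function for $F$.
   Context: A formal language is a set of expressions, each with a unique precise syntactic structure; a sublanguage is a subset. An interpreted language is a triple $I=(L,D_{\rm sem},V_{\rm sem})$ with $L$ a formal language, $D_{\rm sem}$ a nonempty set, and $V_{\rm sem}:L\to D_{\rm sem}$ total. A syntax framework for $(L_{\rm obj},I)$ is a tuple $F=(D_{\rm syn},V_{\rm syn},L_{\rm syn},Q,E)$ such that: $D_{\rm syn}\subseteq D_{\rm sem}$ is nonempty and $V_{\rm syn}:L_{\rm obj}\to D_{\rm syn}$ is injective and total; $L_{\rm syn}\subseteq L$ and $V_{\rm sem}$ restricted to $L_{\rm syn}$ is a total function into $D_{\rm syn}$; $Q:L_{\rm obj}\to L_{\rm syn}$ is injective and total with $V_{\rm sem}(Q(e))=V_{\rm syn}(e)$ for all $e\in L_{\rm obj}$; and $E:L_{\rm syn}\to L_{\rm obj}$ is a possibly partial function with $V_{\rm sem}(E(e))=V_{\rm sem}(V_{\rm syn}^{ -1}(V_{\rm sem}(e)))$ whenever $E(e)$ is defined. The direct evaluation function $E^{\ast}:L_{\rm syn}\to L_{\rm obj}$ is defined by $E^{\ast}(e)=V_{\rm syn}^{ -1}(V_{\rm sem}(e))$ when $V_{\rm sem}(e)$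 is in the image of $V_{\rm syn}$ and undefined otherwise. $F$ has built-in quotation if there is an operator $\mathsf{quote}$ of the language such that, for all $e\in L_{\rm obj}$, $Q(e)$ is the expression $\mathsf{quote}(e)$ obtained by syntactically applying this operator to $e$; $F$ has built-in evaluation if there is an operator $\mathsf{eval}$ such that, for all $e\in L_{\rm syn}$ with $E(e)$ defined, $E(e)$ is the expression $\mathsf{eval}(e)$ obtained by syntactically applying this operator to $e$. An expression of the form $\mathsf{eval}(\mathsf{quote}(e))$ is syntactically distinct from $e$. -}

module Defs where

open import Data.List using (List; _∷_; [])
open import Data.Maybe using (Maybe; just; nothing)
open import Data.Product using (Σ; Σ-syntax; _×_; _,_)
open import Relation.Binary.PropositionalEquality using (_≡_)
open import Function.Bundles using (_⇔_)

-- Syntactically distinct expressions are distinct elements of this type.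
data Expr (Sym : Set) : Set where
  node : Sym → List (Expr Sym) → Expr Sym

apply : {Sym : Set} → Sym → Expr Sym → Expr Sym
apply o e = node o (e ∷ [])

Language : Set → Set₁
Language Sym = Expr Sym → Set

record InterpretedLanguage (Sym : Set) : Set₁ where
  field
    L             : Language Sym
    Dsem          : Set
    Dsem-nonempty : Dsem
    Vsem          : (e : Expr Sym) → L e → Dsem

record SyntaxFramework {Sym : Set} (I : InterpretedLanguage Sym)
         (Lobj : Language Sym) (Lobj⊆L : ∀ e → Lobj e → InterpretedLanguage.L I e) : Set₁ where
  open InterpretedLanguage I
  field
    Dsyn          : Dsem → Set
    Dsyn-nonempty : Σ Dsem Dsyn
    Vsyn          : (e : Expr Sym) → Lobj e → Dsem
    Vsyn-into     : ∀ e p → Dsyn (Vsyn e p)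
    Vsyn-inj      : ∀ e e′ p p′ → Vsyn e p ≡ Vsyn e′ p′ → e ≡ e′
    Lsyn          : Language Sym
    Lsyn⊆L        : ∀ e → Lsyn e → L e
    Vsem-Lsyn     : ∀ e p → Dsyn (Vsem e (Lsyn⊆L e p))
    Q             : (e : Expr Sym) → Lobj e → Expr Sym
    Q-into        : ∀ e p → Lsyn (Q e p)
    Q-inj         : ∀ e e′ p p′ → Q e p ≡ Q e′ p′ → e ≡ e′
    Q-sem         : ∀ e p → Vsem (Q e p) (Lsyn⊆L (Q e p) (Q-into e p)) ≡ Vsyn e p
    -- E : Lsyn ⇀ Lobj partial, with Vsem (E e) = Vsem (Vsyn⁻¹ (Vsem e)) when E e is defined
    E             : (e : Expr Sym) → Lsyn e → Maybe (Expr Sym)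
    E-into        : ∀ e p e′ → E e p ≡ just e′ → Lobj e′
    E-sem         : ∀ e p e′ (eq : E e p ≡ just e′) →
                    Σ (Expr Sym) λ e″ → Σ (Lobj e″) λ q →
                      (Vsyn e″ q ≡ Vsem e (Lsyn⊆L e p))
                      × (Vsem e′ (Lobj⊆L e′ (E-into e p e′ eq)) ≡ Vsem e″ (Lobj⊆L e″ q))

  -- Graph of the direct evaluation function E*: E*(e) = Vsyn⁻¹(Vsem e),
  -- defined iff Vsem e is in the image of Vsyn.
  E*-graph : (e : Expr Sym) → Lsyn e → Expr Sym → Set
  E*-graph e p e′ = Σ (Lobj e′) λ q → Vsyn e′ q ≡ Vsem e (Lsyn⊆L e p)

  E≡E* : Set
  E≡E* = ∀ e (p : Lsyn e) e′ → (E e p ≡ just e′) ⇔ E*-graph e p e′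

  HasBuiltInQuotation : Set
  HasBuiltInQuotation = Σ Sym λ quoteOp → ∀ e (p : Lobj e) → Q e p ≡ apply quoteOp e

  HasBuiltInEvaluation : Set
  HasBuiltInEvaluation = Σ Sym λ evalOp → ∀ e (p : Lsyn e) e′ → E e p ≡ just e′ → e′ ≡ apply evalOp e

-- Quotation is inverted by direct evaluation: Vsem (quote e) = Vsyn e, so E*(quote e) = e.
-- If E were E*, built-in evaluation would make e the expression eval(quote e),
-- which is strictly larger than e.
module Submission where

open import Defs
open import Data.List using (List; _∷_; [])
open import Data.Maybe using (just)
open import Data.Nat using (ℕ; suc; _+_; _<_; s≤s)
open import Data.Nat.Properties using (<-irrefl; <-trans; m≤m+n)
open import Data.Product using (Σ; _,_)
open import Function.Bundles using (Equivalence)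
open import Relation.Binary.PropositionalEquality using (_≡_; refl; sym; trans; cong; subst)
open import Relation.Nullary using (¬_)

size : {Sym : Set} → Expr Sym → ℕ
sizes : {Sym : Set} → List (Expr Sym) → ℕ
size (node _ es) = suc (sizes es)
sizes [] = 0
sizes (e ∷ es) = size e + sizes es

size-<-apply : {Sym : Set} (o : Sym) (e : Expr Sym) → size e < size (apply o e)
size-<-apply o e = s≤s (m≤m+n (size e) 0)

apply-apply-≢ : {Sym : Set} (o o′ : Sym) (e : Expr Sym) → ¬ (e ≡ apply o (apply o′ e))
apply-apply-≢ o o′ e eq =
  <-irrefl refl (subst (λ x → size e < size x) (sym eq)
    (<-trans (size-<-apply o′ e) (size-<-apply o (apply o′ e))))

module _ {Sym : Set} {I : InterpretedLanguage Sym} {Lobj : Language Sym}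
         {Lobj⊆L : ∀ e → Lobj e → InterpretedLanguage.L I e}
         (F : SyntaxFramework I Lobj Lobj⊆L) where
  open SyntaxFramework F

  E*-graph-Q : ∀ e (p : Lobj e) → E*-graph (Q e p) (Q-into e p) e
  E*-graph-Q e p = p , sym (Q-sem e p)

  E≡E*⇒E-Q : E≡E* → ∀ e (p : Lobj e) → E (Q e p) (Q-into e p) ≡ just e
  E≡E*⇒E-Q E≡E*-holds e p =
    Equivalence.from (E≡E*-holds (Q e p) (Q-into e p) e) (E*-graph-Q e p)

mainTheorem3 : {Sym : Set} (I : InterpretedLanguage Sym) (Lobj : Language Sym)
    (Lobj⊆L : ∀ e → Lobj e → InterpretedLanguage.L I e)
    (F : SyntaxFramework I Lobj Lobj⊆L) →
    SyntaxFramework.HasBuiltInQuotation F →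
    SyntaxFramework.HasBuiltInEvaluation F →
    Σ (Expr Sym) Lobj →
    ¬ SyntaxFramework.E≡E* F
mainTheorem3 I Lobj Lobj⊆L F (quoteOp , Q≡quote) (evalOp , E≡eval) (e , p) E≡E*-holds =
  apply-apply-≢ evalOp quoteOp e e≡eval-quote-e
  where
  open SyntaxFramework F

  e≡eval-quote-e : e ≡ apply evalOp (apply quoteOp e)
  e≡eval-quote-e =
    trans (E≡eval (Q e p) (Q-into e p) e (E≡E*⇒E-Q F E≡E*-holds e p))
          (cong (apply evalOp) (Q≡quote e p))
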